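{- Let $\Gamma$ be a family of 1-regular digraphs all having the same vertex set $V$, $|V|=n$, each identified with a permutation of $V$. Let $C_m^+$ have vertices $a_1,\dots,a_m$ and arcs $(a_i,a_{i+1})$ ($1\le i\le m-1$) and $(a_m,a_1)$, let $h:E(C_m^+)\to\Gamma$ be any function, and let $P_h=h(a_ma_1)\cdots h(a_2a_3)\cdot h(a_1a_2)$ (composition, with $h(a_1a_2)$ applied first). Let $\sigma_1\cdots\sigma_s$ be the disjoint cyclic decomposition of $P_h$ (including cycles of length $1$), and $|\sigma_j|$ the length of $\sigma_j$. Then every cycle in the disjoint cyclic decomposition of $P_h$ corresponds to a strongly connected component of $C_m^+\otimes_h\Gamma$, and the component corresponding to $\sigma_j$ is a strongly oriented cycle of length $m|\sigma_j|$. That is, $$C_m^+\otimes_h\Gamma\cong C^+_{m|\sigma_1|}+C^+_{m|\sigma_2|}+\cdots+C^+_{m|\sigma_s|}.$$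
   Context: A 1-regular digraph $F$ on $V$ (all in- and out-degrees $1$) is identified with the permutation $\pi$ of $V$ with $\pi(x)=y$ iff $(x,y)\in E(F)$. Product: for a digraph $D$, a family $\Gamma$ of digraphs with common vertex set $V$ and $h:E(D)\to\Gamma$, $D\otimes_h\Gamma$ has vertex set $V(D)\times V$ and $((a,x),(b,y))$ is an arc iff $(a,b)\in E(D)$ and $(x,y)\in E(h(a,b))$. $C_k^+$ denotes a strongly oriented cycle of length $k$ and $+$ denotes disjoint union. -}

module Defs where

open import Data.Nat as ℕ using (ℕ; zero; suc; _≤_; s≤s; z≤n)
open import Data.Fin using (Fin; zero; suc; toℕ; fromℕ<)
open import Data.Fin.Permutation using (Permutation′; _⟨$⟩ʳ_)
open import Data.Product using (Σ; _×_; _,_)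
open import Data.List using (List; []; _∷_; map)
open import Data.Fin.Base using () renaming (zero to fz)
open import Data.List using () renaming (map to lmap)
open import Data.Fin using (Fin)
open import Function.Bundles using (_↔_; _⇔_; Inverse)
open import Relation.Binary.PropositionalEquality using (_≡_; refl)
open import Relation.Nullary using (yes; no)

record Digraph : Set₁ where
  field
    Vert : Set
    Arc  : Vert → Vert → Set
open Digraph public

next : ∀ {k} → Fin k → Fin k
next {suc k} i with toℕ i ℕ.<? k
... | yes p = fromℕ< (s≤s p)
... | no _  = zero

C⁺ : ℕ → Digraph
C⁺ k = record { Vert = Fin k ; Arc = λ a b → b ≡ next a }

PermDigraph : ∀ {n} → Permutation′ n → Fin n → Fin n → Set
PermDigraph π x y = π ⟨$⟩ʳ x ≡ y

_⊗[_] : (D : Digraph) {V : Set} → (∀ {a b} → Arc D a b → V → V → Set) → Digraph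
D ⊗[ h ] = record
  { Vert = Vert D × _
  ; Arc  = λ { (a , x) (b , y) → Σ (Arc D a b) (λ e → h e x y) }
  }

data SumArc {s : ℕ} (D : Fin s → Digraph) :
            Σ (Fin s) (λ j → Vert (D j)) → Σ (Fin s) (λ j → Vert (D j)) → Set where
  inj : ∀ {j u v} → Arc (D j) u v → SumArc D (j , u) (j , v)

⨁ : (s : ℕ) → (Fin s → Digraph) → Digraph
⨁ s D = record { Vert = Σ (Fin s) (λ j → Vert (D j)) ; Arc = SumArc D }

record _≅_ (D E : Digraph) : Set where
  field
    iso : Vert D ↔ Vert E
    arc : ∀ u v → Arc D u v ⇔ Arc E (Inverse.to iso u) (Inverse.to iso v)
open _≅_ public

applyAll : ∀ {A : Set} → List (A → A) → A → A
applyAll []       x = x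
applyAll (f ∷ fs) x = applyAll fs (f x)

allFinL : (k : ℕ) → List (Fin k)
allFinL zero    = []
allFinL (suc k) = zero ∷ lmap suc (allFinL k)

-- P_h = h(a_m a_1) ∘ ⋯ ∘ h(a_1 a_2) for h : E(C⁺ m) → Γ (arc a → next a, 0-indexed)
Ph : ∀ {m n} {I : Set} (Γ : I → Permutation′ n) →
     (h : ∀ {a b} → Arc (C⁺ m) a b → I) → Fin n → Fin n
Ph {m} Γ h = applyAll (lmap (λ a → λ x → Γ (h {a} {next a} refl) ⟨$⟩ʳ x) (allFinL m))

-- a disjoint cycle decomposition σ_1 ⋯ σ_s of a permutation P (cycles of length 1 included):
-- cycle j is (elt j 0 → elt j 1 → ⋯ → elt j (len j - 1) → elt j 0),
-- the cycles are disjoint, their entries distinct, and they cover Fin n.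
record CycleDecomposition {n : ℕ} (P : Fin n → Fin n) : Set where
  field
    s       : ℕ
    len     : Fin s → ℕ
    len-pos : ∀ j → 1 ≤ len j
    elt     : Σ (Fin s) (λ j → Fin (len j)) ↔ Fin n
    cyc     : ∀ j i → P (Inverse.to elt (j , i)) ≡ Inverse.to elt (j , next i)

first : ∀ {m} → 2 ≤ m → Fin m
first (s≤s _) = zero

-- Both digraphs are functional graphs: in C⁺ m ⊗ Γ every vertex (a , x) has the unique
-- out-neighbour (a + 1 , h(a , a + 1) x), and in a disjoint union of cycles every vertex
-- has its cyclic successor.  It therefore suffices to find a bijection conjugating the
-- two successor maps.  Vertex i·m + a of the j-th cycle C⁺ (m |σ_j|) is sent to
-- (a , Q_a (x_{j,i})), where x_{j,0} → x_{j,1} → ⋯ is the cycle σ_j of P_h and Q_a is the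
-- product of the first a factors of P_h.  Within a block one step applies the next factor;
-- leaving a block completes P_h, which moves x_{j,i} to x_{j,i+1}.
module Submission where

open import Defs
open import Data.Nat using (ℕ; _≤_; _*_)
open import Data.Fin using (Fin)
open import Data.Fin.Permutation using (Permutation′)
open import Data.Product using (Σ; _,_; proj₁)
open import Function.Bundles using (Inverse)
open import Relation.Binary.PropositionalEquality using (_≡_)

open import Data.Nat as ℕ using (suc; zero; _+_; _<_; s≤s)
open import Data.Nat.Properties using (+-suc; +-comm; *-suc; *-comm; +-identityʳ; suc-injective; <-irrefl)
open import Data.Fin as Fin using (toℕ; fromℕ; inject₁; cast; combine; remQuot)
open import Data.Fin.Properties
  using (toℕ-injective; toℕ<n; toℕ-fromℕ; toℕ-fromℕ<; toℕ-inject₁; toℕ-cast; toℕ-combine;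
         cast-involutive; remQuot-combine; combine-remQuot)
open import Data.Fin.Relation.Unary.Top using (view; ‵fromℕ; ‵inject₁)
open import Data.Fin.Permutation using (_⟨$⟩ʳ_; _⟨$⟩ˡ_; _∘ₚ_; id; inverseˡ; inverseʳ)
open import Data.List using () renaming (map to lmap)
open import Data.List.Properties using (map-∘)
open import Data.Product using (_×_; proj₂; uncurry)
open import Function using (_∘_)
open import Function.Bundles using (_↔_; _⇔_; Equivalence; mk↔ₛ′; mk⇔)
open import Relation.Binary.PropositionalEquality
  using (refl; sym; trans; cong; cong₂; subst; module ≡-Reasoning)
open import Relation.Nullary using (yes; no)
open import Data.Empty using (⊥-elim)

open Inverse using (to; from; strictlyInverseˡ; strictlyInverseʳ)

toℕ-next : ∀ {k} (p : Fin (suc k)) → toℕ p < k → toℕ (next p) ≡ suc (toℕ p)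
toℕ-next {k} p p<k with toℕ p ℕ.<? k
... | yes p<k′ = toℕ-fromℕ< (s≤s p<k′)
... | no  p≮k  = ⊥-elim (p≮k p<k)

next-wrap : ∀ {k} (p : Fin (suc k)) → toℕ p ≡ k → next p ≡ Fin.zero
next-wrap {k} p p≡k with toℕ p ℕ.<? k
... | yes p<k = ⊥-elim (<-irrefl p≡k p<k)
... | no  _   = refl

next-≡ : ∀ {k} {p q : Fin (suc k)} → suc (toℕ p) ≡ toℕ q → next p ≡ q
next-≡ {k} {p} {q} eq = toℕ-injective (trans (toℕ-next p p<k) eq)
  where
  p<k : toℕ p < k
  p<k = ℕ.s≤s⁻¹ (subst (_< suc k) (sym eq) (toℕ<n q))

next-inject₁ : ∀ {k} (a : Fin k) → next (inject₁ a) ≡ Fin.suc a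
next-inject₁ a = next-≡ (cong suc (toℕ-inject₁ a))

next-fromℕ : ∀ k → next (fromℕ k) ≡ Fin.zero
next-fromℕ k = next-wrap (fromℕ k) (toℕ-fromℕ k)

-- Mixed-radix positions: digit a of block i sits at position (suc m) · i + a

module MixedRadix (m : ℕ) where

  comb : ∀ {L} → Fin L → Fin (suc m) → Fin (suc m * L)
  comb {L} i a = cast (*-comm L (suc m)) (combine i a)

  split : ∀ {L} → Fin (suc m * L) → Fin L × Fin (suc m)
  split {L} p = remQuot (suc m) (cast (*-comm (suc m) L) p)

  split-comb : ∀ {L} (i : Fin L) a → split (comb i a) ≡ (i , a)
  split-comb {L} i a = trans
    (cong (remQuot (suc m)) (cast-involutive (*-comm (suc m) L) (*-comm L (suc m)) (combine i a)))
    (remQuot-combine i a)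

  comb-split : ∀ {L} (p : Fin (suc m * L)) → uncurry comb (split p) ≡ p
  comb-split {L} p = trans (cong (cast (*-comm L (suc m))) (combine-remQuot {L} (suc m) _))
                           (cast-involutive (*-comm L (suc m)) (*-comm (suc m) L) p)

  toℕ-comb : ∀ {L} (i : Fin L) a → toℕ (comb i a) ≡ suc m * toℕ i + toℕ a
  toℕ-comb i a = trans (toℕ-cast _ (combine i a)) (toℕ-combine i a)

  carry : ∀ t → suc (suc m * t + m) ≡ suc m * suc t
  carry t = begin
    suc (suc m * t + m)  ≡⟨ +-suc (suc m * t) m ⟨
    suc m * t + suc m    ≡⟨ +-comm (suc m * t) (suc m) ⟩
    suc m + suc m * t    ≡⟨ *-suc (suc m) t ⟨
    suc m * suc t        ∎
    where open ≡-Reasoning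

  next-comb-inject₁ : ∀ {L} (i : Fin L) (a : Fin m) →
                      next (comb i (inject₁ a)) ≡ comb i (Fin.suc a)
  next-comb-inject₁ {suc _} i a = next-≡ (begin
    suc (toℕ (comb i (inject₁ a)))       ≡⟨ cong suc (toℕ-comb i (inject₁ a)) ⟩
    suc (suc m * toℕ i + toℕ (inject₁ a)) ≡⟨ cong (λ t → suc (suc m * toℕ i + t)) (toℕ-inject₁ a) ⟩
    suc (suc m * toℕ i + toℕ a)           ≡⟨ +-suc (suc m * toℕ i) (toℕ a) ⟨
    suc m * toℕ i + suc (toℕ a)           ≡⟨ toℕ-comb i (Fin.suc a) ⟨
    toℕ (comb i (Fin.suc a))              ∎)
    where open ≡-Reasoning

  next-comb-fromℕ : ∀ {L} (i : Fin L) → next (comb i (fromℕ m)) ≡ comb (next i) Fin.zero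
  next-comb-fromℕ {suc l} i with view i
  ... | ‵inject₁ i′ = trans (next-≡ (begin
    suc (toℕ (comb (inject₁ i′) (fromℕ m)))  ≡⟨ cong suc (toℕ-comb (inject₁ i′) (fromℕ m)) ⟩
    suc (suc m * toℕ (inject₁ i′) + toℕ (fromℕ m))
      ≡⟨ cong₂ (λ t u → suc (suc m * t + u)) (toℕ-inject₁ i′) (toℕ-fromℕ m) ⟩
    suc (suc m * toℕ i′ + m)                  ≡⟨ carry (toℕ i′) ⟩
    suc m * suc (toℕ i′)                      ≡⟨ +-identityʳ _ ⟨
    suc m * suc (toℕ i′) + 0                  ≡⟨ toℕ-comb (Fin.suc i′) Fin.zero ⟨
    toℕ (comb (Fin.suc i′) Fin.zero)          ∎))
    (cong (λ j → comb j Fin.zero) (sym (next-inject₁ i′)))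
    where open ≡-Reasoning
  ... | ‵fromℕ = trans (next-wrap _ (suc-injective (begin
    suc (toℕ (comb (fromℕ l) (fromℕ m)))  ≡⟨ cong suc (toℕ-comb (fromℕ l) (fromℕ m)) ⟩
    suc (suc m * toℕ (fromℕ l) + toℕ (fromℕ m))
      ≡⟨ cong₂ (λ t u → suc (suc m * t + u)) (toℕ-fromℕ l) (toℕ-fromℕ m) ⟩
    suc (suc m * l + m)                    ≡⟨ carry l ⟩
    suc m * suc l                          ∎)))
    (cong (λ j → comb j Fin.zero) (sym (next-fromℕ l)))
    where open ≡-Reasoning

-- prefix F a applies F 0, …, F (a - 1) in this order (_∘ₚ_ composes diagrammatically)

module _ {n : ℕ} where

  prefix : ∀ {k} → (Fin k → Permutation′ n) → Fin k → Permutation′ n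
  prefix F Fin.zero    = id
  prefix F (Fin.suc a) = F Fin.zero ∘ₚ prefix (F ∘ Fin.suc) a

  prefix-suc : ∀ {k} (F : Fin (suc k) → Permutation′ n) (a : Fin k) x →
               prefix F (Fin.suc a) ⟨$⟩ʳ x ≡ F (inject₁ a) ⟨$⟩ʳ (prefix F (inject₁ a) ⟨$⟩ʳ x)
  prefix-suc F Fin.zero    x = refl
  prefix-suc F (Fin.suc a) x = prefix-suc (F ∘ Fin.suc) a (F Fin.zero ⟨$⟩ʳ x)

  composeAll : ∀ {k} → (Fin k → Permutation′ n) → Fin n → Fin n
  composeAll {k} F = applyAll (lmap (λ a x → F a ⟨$⟩ʳ x) (allFinL k))

  composeAll-prefix : ∀ {k} (F : Fin (suc k) → Permutation′ n) x →
                      composeAll F x ≡ F (fromℕ k) ⟨$⟩ʳ (prefix F (fromℕ k) ⟨$⟩ʳ x)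
  composeAll-prefix {zero}  F x = refl
  composeAll-prefix {suc k} F x = trans
    (cong (λ fs → applyAll fs (F Fin.zero ⟨$⟩ʳ x)) (sym (map-∘ (allFinL (suc k)))))
    (composeAll-prefix (F ∘ Fin.suc) (F Fin.zero ⟨$⟩ʳ x))

IsFunctionalGraph : (D : Digraph) → (Vert D → Vert D) → Set
IsFunctionalGraph D f = ∀ u v → Arc D u v ⇔ (v ≡ f u)

≅-functionalGraph : ∀ {D E f g} → IsFunctionalGraph D f → IsFunctionalGraph E g →
                    (φ : Vert D ↔ Vert E) → (∀ q → from φ (g q) ≡ f (from φ q)) → D ≅ E
≅-functionalGraph {D} {E} {f} {g} D-f E-g φ conj = record
  { iso = φ
  ; arc = λ u v → mk⇔ (Equivalence.from (E-g _ _) ∘ forth u v ∘ Equivalence.to (D-f u v))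
                      (Equivalence.from (D-f u v) ∘ back u v ∘ Equivalence.to (E-g _ _))
  }
  where
  open ≡-Reasoning
  forth : ∀ u v → v ≡ f u → to φ v ≡ g (to φ u)
  forth u v refl = begin
    to φ (f u)                   ≡⟨ cong (to φ ∘ f) (strictlyInverseʳ φ u) ⟨
    to φ (f (from φ (to φ u)))   ≡⟨ cong (to φ) (conj (to φ u)) ⟨
    to φ (from φ (g (to φ u)))   ≡⟨ strictlyInverseˡ φ _ ⟩
    g (to φ u)                   ∎
  back : ∀ u v → to φ v ≡ g (to φ u) → v ≡ f u
  back u v eq = begin
    v                            ≡⟨ strictlyInverseʳ φ v ⟨
    from φ (to φ v)              ≡⟨ cong (from φ) eq ⟩
    from φ (g (to φ u))          ≡⟨ conj (to φ u) ⟩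
    f (from φ (to φ u))          ≡⟨ cong f (strictlyInverseʳ φ u) ⟩
    f u                          ∎

C⁺-functional : ∀ k → IsFunctionalGraph (C⁺ k) next
C⁺-functional k u v = mk⇔ (λ e → e) (λ e → e)

⨁-functional : ∀ {s} {D : Fin s → Digraph} {f : ∀ j → Vert (D j) → Vert (D j)} →
               (∀ j → IsFunctionalGraph (D j) (f j)) →
               IsFunctionalGraph (⨁ s D) (λ (j , u) → j , f j u)
⨁-functional {f = f} D-f (j , u) v = mk⇔ forth back
  where
  forth : SumArc _ (j , u) v → v ≡ (j , f j u)
  forth (inj e) = cong (j ,_) (Equivalence.to (D-f j u _) e)
  back : v ≡ (j , f j u) → SumArc _ (j , u) v
  back refl = inj (Equivalence.from (D-f j u _) refl)

⊗-functional : ∀ {k n} (F : ∀ {a b} → Arc (C⁺ k) a b → Permutation′ n) →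
               IsFunctionalGraph (C⁺ k ⊗[ (λ e → PermDigraph (F e)) ])
                                 (λ (a , x) → next a , F {a} refl ⟨$⟩ʳ x)
⊗-functional F (a , x) (b , y) = mk⇔ (λ { (refl , Fx≡y) → cong (next a ,_) (sym Fx≡y) })
                                     (λ { refl → refl , refl })

module Unrolling {m n : ℕ} (F : ∀ {a b} → Arc (C⁺ (suc m)) a b → Permutation′ n)
                 (σ : CycleDecomposition (composeAll (λ a → F {a} refl))) where
  open CycleDecomposition σ
  open MixedRadix m

  step : Fin (suc m) → Permutation′ n
  step a = F {a} refl

  Q : Fin (suc m) → Permutation′ n
  Q = prefix step

  place : Fin (suc m) → Σ (Fin s) (λ j → Fin (len j)) → Σ (Fin s) (λ j → Fin (suc m * len j))
  place a (j , i) = j , comb i a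

  rolled : Fin (suc m) × Fin n → Σ (Fin s) (λ j → Fin (suc m * len j))
  rolled (a , x) = place a (from elt (Q a ⟨$⟩ˡ x))

  visit : (j : Fin s) → Fin (len j) × Fin (suc m) → Fin (suc m) × Fin n
  visit j (i , a) = a , Q a ⟨$⟩ʳ to elt (j , i)

  unrolled : Σ (Fin s) (λ j → Fin (suc m * len j)) → Fin (suc m) × Fin n
  unrolled (j , p) = visit j (split p)

  unrolled-comb : ∀ j i a → unrolled (j , comb i a) ≡ visit j (i , a)
  unrolled-comb j i a = cong (visit j) (split-comb i a)

  rolled-unrolled : ∀ q → rolled (unrolled q) ≡ q
  rolled-unrolled (j , p) = begin
    place a (from elt (Q a ⟨$⟩ˡ (Q a ⟨$⟩ʳ to elt (j , i))))  ≡⟨ cong (place a ∘ from elt) (inverseˡ (Q a)) ⟩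
    place a (from elt (to elt (j , i)))                    ≡⟨ cong (place a) (strictlyInverseʳ elt (j , i)) ⟩
    (j , comb i a)                                         ≡⟨ cong (j ,_) (comb-split p) ⟩
    (j , p)                                                ∎
    where
    open ≡-Reasoning
    i = proj₁ (split p)
    a = proj₂ (split p)

  unrolled-rolled : ∀ v → unrolled (rolled v) ≡ v
  unrolled-rolled (a , x) = begin
    unrolled (j , comb i a)             ≡⟨ unrolled-comb j i a ⟩
    (a , Q a ⟨$⟩ʳ to elt (from elt y))  ≡⟨ cong (λ z → a , Q a ⟨$⟩ʳ z) (strictlyInverseˡ elt y) ⟩
    (a , Q a ⟨$⟩ʳ (Q a ⟨$⟩ˡ x))          ≡⟨ cong (a ,_) (inverseʳ (Q a)) ⟩
    (a , x)                             ∎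
    where
    open ≡-Reasoning
    y = Q a ⟨$⟩ˡ x
    j = proj₁ (from elt y)
    i = proj₂ (from elt y)

  advance : Fin (suc m) × Fin n → Fin (suc m) × Fin n
  advance (a , x) = next a , step a ⟨$⟩ʳ x

  unrolled-next-comb : ∀ j i a → unrolled (j , next (comb i a)) ≡ advance (visit j (i , a))
  unrolled-next-comb j i a with view a
  ... | ‵inject₁ a′ = begin
    unrolled (j , next (comb i (inject₁ a′)))  ≡⟨ cong (unrolled ∘ (j ,_)) (next-comb-inject₁ i a′) ⟩
    unrolled (j , comb i (Fin.suc a′))         ≡⟨ unrolled-comb j i (Fin.suc a′) ⟩
    visit j (i , Fin.suc a′)                   ≡⟨ cong₂ _,_ (next-inject₁ a′) (sym (prefix-suc step a′ _)) ⟨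
    advance (visit j (i , inject₁ a′))         ∎
    where open ≡-Reasoning
  ... | ‵fromℕ = begin
    unrolled (j , next (comb i (fromℕ m)))     ≡⟨ cong (unrolled ∘ (j ,_)) (next-comb-fromℕ i) ⟩
    unrolled (j , comb (next i) Fin.zero)      ≡⟨ unrolled-comb j (next i) Fin.zero ⟩
    (Fin.zero , to elt (j , next i))           ≡⟨ cong₂ _,_ (next-fromℕ m) (cyc j i) ⟨
    (next (fromℕ m) , composeAll step (to elt (j , i)))
                                               ≡⟨ cong (next (fromℕ m) ,_) (composeAll-prefix step _) ⟩
    advance (visit j (i , fromℕ m))            ∎
    where open ≡-Reasoning

  unrolled-next : ∀ q → unrolled (proj₁ q , next (proj₂ q)) ≡ advance (unrolled q)
  unrolled-next (j , p) = subst (λ p → unrolled (j , next p) ≡ advance (unrolled (j , p)))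
    (comb-split p)
    (trans (unrolled-next-comb j i a) (cong advance (sym (unrolled-comb j i a))))
    where
    i = proj₁ (split p)
    a = proj₂ (split p)

  rolling : Vert (C⁺ (suc m) ⊗[ (λ e → PermDigraph (F e)) ]) ↔ Vert (⨁ s (λ j → C⁺ (suc m * len j)))
  rolling = mk↔ₛ′ rolled unrolled rolled-unrolled unrolled-rolled

  ⊗≅⨁ : (C⁺ (suc m) ⊗[ (λ e → PermDigraph (F e)) ]) ≅ ⨁ s (λ j → C⁺ (suc m * len j))
  ⊗≅⨁ = ≅-functionalGraph (⊗-functional F) (⨁-functional (λ j → C⁺-functional _))
                          rolling unrolled-next

  rolled-zero : ∀ j i → proj₁ (rolled (Fin.zero , to elt (j , i))) ≡ j
  rolled-zero j i = cong proj₁ (strictlyInverseʳ elt (j , i))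

theorem2p6 : (n m : ℕ) (m≥2 : 2 ≤ m) (I : Set) (Γ : I → Permutation′ n)
             (h : ∀ {a b} → Arc (C⁺ m) a b → I)
             (σ : CycleDecomposition (Ph Γ h)) →
             let open CycleDecomposition σ in
             Σ ((C⁺ m ⊗[ (λ e → PermDigraph (Γ (h e))) ]) ≅ ⨁ s (λ j → C⁺ (m * len j)))
               (λ φ → ∀ j i → proj₁ (Inverse.to (iso φ) (first m≥2 , Inverse.to elt (j , i))) ≡ j)
theorem2p6 n (suc m) (s≤s _) I Γ h σ = ⊗≅⨁ , rolled-zero
  where open Unrolling (Γ ∘ h) σ
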